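{- For all integers $k,n\geqslant 0$, there is a bijection between the maximal chains in the poset $\Sigma^k_n C^n_1$ and the words $w$ of length $(k+1)n$ over an alphabet $\{a_1,\dots,a_n\}$ of $n$ distinct letters such that each letter occurs exactly $k+1$ times in $w$, and for each prefix $z$ of $w$ and each $i$, either $a_i$ does not occur in $z$, or for each $j>i$ the letter $a_i$ occurs in $z$ at least as many times as $a_j$.
   Context: For $r\geqslant 0$, $C_r$ is the chain $\{0<1<\dots<r\}$ and $C_r^n$ its $n$-th cartesian power with componentwise order. Stacking (lax sum): given a sequence of posets $M_0,M_1,\dots$ with monotone maps $f_j\colon M_j\to M_{j+1}$, the poset $\Sigma_nM_n$ has elements the pairs $(x,j)$ with $0\leqslant j\leqslant n$, $x\in M_j$, ordered by $(x,j)\leqslant(y,k)$ iff $j\leqslant k$ and $(f_{k-1}\circ\dots\circ f_j)(x)\leqslant y$ in $M_k$ (identity composite when $j=k$). The maps $(x,j)\mapsto(x,j)$ from $\Sigma_nM_n$ to $\Sigma_{n+1}M_{n+1}$ make $(\Sigma_nM_n)_n$ a sequence of the same kind. Iterated stacking: $\Sigma^0_nM_n=M_n$ and $\Sigma^{k}_nM_n$ is the stacking of $(\Sigma^{k-1}_nM_n)_n$. $\Sigma^k_nC^n_1$ is the $k$-iterated stacking of $C^0_1\to C^1_1\to\dots$ with maps $(x_1,\dots,x_i)\mapsto(0,x_1,\dots,x_i)$. -}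

module Defs where

open import Level using (0ℓ)
open import Data.Nat using (ℕ; zero; suc; _+_; _*_; _≤_)
open import Data.Bool using (Bool; false)
import Data.Bool as B
open import Data.Fin using (Fin)
import Data.Fin as F
open import Data.Vec using (Vec; _∷_)
open import Data.Vec.Relation.Binary.Pointwise.Inductive using (Pointwise)
open import Data.List using (List; length; filter; _++_)
open import Data.List.Membership.Propositional using (_∈_)
open import Data.List.Relation.Unary.AllPairs using (AllPairs)
open import Data.Product using (Σ; _×_; _,_)
open import Data.Sum using (_⊎_)
open import Data.Refinement using (Refinement)
open import Relation.Binary.PropositionalEquality using (_≡_; _≢_; subst)

-- C_1^n is Vec Bool n (false = 0, true = 1), componentwise order.
-- Σ^{k+1}_n M = pairs (j , x) with 0 ≤ j ≤ n, x ∈ Σ^k_j M.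

El : ℕ → ℕ → Set
El zero    n = Vec Bool n
El (suc k) n = Σ ℕ (λ j → (j ≤ n) × El k j)

step : (k n : ℕ) → El k n → El k (suc n)
step zero    n x             = false ∷ x
step (suc k) n (j , p , x)   = j , Data.Nat.Properties.m≤n⇒m≤1+n p , x
  where import Data.Nat.Properties

iter : (k j d : ℕ) → El k j → El k (d + j)
iter k j zero    x = x
iter k j (suc d) x = step k (d + j) (iter k j d x)

Le : (k n : ℕ) → El k n → El k n → Set
Le zero    n x y = Pointwise B._≤_ x y
Le (suc k) n (j , _ , x) (m , _ , y) =
  Σ ℕ λ d → Σ (d + j ≡ m) λ e → Le k m (subst (El k) e (iter k j d x)) y

Lt : (k n : ℕ) → El k n → El k n → Set
Lt k n x y = Le k n x y × x ≢ y

IsChain : (k n : ℕ) → List (El k n) → Set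
IsChain k n L = AllPairs (Lt k n) L

IsMaximalChain : (k n : ℕ) → List (El k n) → Set
IsMaximalChain k n L =
  IsChain k n L ×
  ((D : List (El k n)) → IsChain k n D →
     (∀ x → x ∈ L → x ∈ D) → (∀ x → x ∈ D → x ∈ L))

MaxChain : ℕ → ℕ → Set
MaxChain k n = Refinement (List (El k n)) (IsMaximalChain k n)

-- Words over the alphabet {a_1,…,a_n}, letter a_{i+1} represented by i : Fin n.

occ : {n : ℕ} → Fin n → List (Fin n) → ℕ
occ i z = length (filter (F._≟ i) z)

IsGoodWord : (k n : ℕ) → List (Fin n) → Set
IsGoodWord k n w =
  (length w ≡ suc k * n) ×
  ((i : Fin n) → occ i w ≡ suc k) ×
  ((z r : List (Fin n)) → z ++ r ≡ w → (i : Fin n) →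
     (occ i z ≡ 0) ⊎ ((j : Fin n) → i F.< j → occ j z ≤ occ i z))

Word : ℕ → ℕ → Set
Word k n = Refinement (List (Fin n)) (IsGoodWord k n)

-- Encode an element of Σ^k_n C_1^n by a vector in ℕ^n: a 0/1-vector when k = 0, and for (j , x) the
-- n − j zeros followed by the code of x raised by one. This is an order embedding for the componentwise
-- order, onto the vectors v with entries ≤ k + 1 such that v_i ≤ v_j or k ≤ v_j whenever i < j.
-- Covers are increments of one coordinate, and below any w above u in the image there is such an
-- increment of u inside the image; so maximal chains are the lattice paths from 0 to (k+1, …, k+1)
-- through the image, i.e. the words whose prefix counts stay in it. Read backwards, a prefix of the path
-- is a suffix of the word, whose counts are k + 1 minus those of the complementary prefix: in these terms
-- the image condition says that for i < j the prefix count of a_j is at most that of a_i or at most 1.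
-- This is the good-word condition, because if a_i is absent from a prefix, cutting the word right after
-- the first occurrence of a_i leaves a prefix in which a_i, hence every later a_j, occurs at most once.

module Submission where

open import Defs
open import Level using (0ℓ)
open import Data.Nat as ℕ using (ℕ; zero; suc; _+_; _*_; z≤n; s≤s; _≤′_; ≤′-refl; ≤′-step)
import Data.Nat.Properties as ℕ
open import Data.Bool as Bool using (Bool; true; false)
open import Data.Fin as Fin using (Fin)
open import Data.Fin.Properties using (all?)
open import Data.Vec as Vec using (Vec; []; _∷_; lookup; updateAt; replicate; map)
import Data.Vec.Properties as Vec
open import Data.Vec.Relation.Binary.Pointwise.Inductive as Pointwise using (Pointwise; []; _∷_)
open import Data.List as List using (List; []; _∷_; _++_; length; reverse; filter)
import Data.List.Properties as List
open import Data.List.Relation.Unary.Any using (here; there)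
open import Data.List.Relation.Unary.All as All using (All; []; _∷_)
open import Data.List.Relation.Unary.AllPairs using (AllPairs; []; _∷_)
open import Data.List.Membership.Propositional using (_∈_; _∉_)
import Data.List.Membership.DecPropositional as DecMembership
open import Data.Maybe as Maybe using (Maybe; just; nothing; maybe′; _>>=_)
import Data.Maybe.Properties as Maybe
open import Data.Product as Product using (Σ; ∃₂; _×_; _,_; proj₁; proj₂)
open import Data.Sum as Sum using (_⊎_; inj₁; inj₂)
open import Data.Empty using (⊥; ⊥-elim)
open import Data.Irrelevant using ([_])
open import Data.Refinement as Refinement using (Refinement; _,_; value; value-injective)
open import Function.Bundles using (_⤖_; mk↔ₛ′)
open import Function.Construct.Composition using (_⤖-∘_)
open import Function.Properties.Inverse using (↔⇒⤖)
open import Relation.Nullary using (yes; no; Dec)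
open import Relation.Nullary.Decidable using (map′; recompute; _×-dec_; _⊎-dec_; _→-dec_)
open import Relation.Binary.Core using (Rel)
open import Relation.Binary.Definitions using (DecidableEquality)
open import Relation.Binary.Structures using (IsPartialOrder)
open import Relation.Binary.PropositionalEquality hiding (isPartialOrder)
open ≡-Reasoning

-- Maximal chains as label sequences of covering steps

module MaximalChains
  {A : Set} {_≤_ : Rel A 0ℓ} (isPartialOrder : IsPartialOrder _≡_ _≤_)
  (_≟_ : DecidableEquality A)
  (bottom top : A) (bottom-least : ∀ x → bottom ≤ x) (top-greatest : ∀ x → x ≤ top)
  {n : ℕ} (up : A → Fin n → Maybe A) (label : A → A → Maybe (Fin n))
  (up-increasing : ∀ {x i y} → up x i ≡ just y → x ≤ y × x ≢ y)
  (up-covers : ∀ {x i y z} → up x i ≡ just y → x ≤ z → z ≤ y → z ≡ x ⊎ z ≡ y)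
  (up-towards : ∀ {x y} → x ≤ y → x ≢ y → ∃₂ λ i z → up x i ≡ just z × z ≤ y)
  (label-up : ∀ {x i y} → up x i ≡ just y → label x y ≡ just i)
  where

  open IsPartialOrder isPartialOrder using (antisym) renaming (refl to ≤-refl; trans to ≤-trans)
  open import Relation.Binary.Construct.NonStrictToStrict _≡_ _≤_ using (_<_; <-trans)
  open DecMembership _≟_ using (_∈?_)

  Chain : List A → Set
  Chain = AllPairs _<_

  Maximal : List A → Set
  Maximal L = Chain L × ((D : List A) → Chain D → (∀ x → x ∈ L → x ∈ D) → (∀ x → x ∈ D → x ∈ L))

  Comparable : A → A → Set
  Comparable x y = x ≤ y ⊎ y ≤ x

  Saturated : A → List A → Set
  Saturated x L = ∀ z → x ≤ z → (∀ w → w ∈ L → Comparable w z) → z ∈ L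

  run : A → List (Fin n) → Maybe A
  run x []      = just x
  run x (i ∷ m) = up x i >>= λ y → run y m

  trace traceTail : A → List (Fin n) → List A
  trace x m = x ∷ traceTail x m
  traceTail x []      = []
  traceTail x (i ∷ m) = maybe′ (λ y → trace y m) [] (up x i)

  labels : List A → List (Fin n)
  labels []           = []
  labels (x ∷ [])     = []
  labels (x ∷ y ∷ L) = maybe′ (_∷ labels (y ∷ L)) (labels (y ∷ L)) (label x y)

  <-≤-trans : ∀ {x y z} → x < y → y ≤ z → x < z
  <-≤-trans (x≤y , x≢y) y≤z = ≤-trans x≤y y≤z , λ { refl → x≢y (antisym x≤y y≤z) }

  ≤-<-irrefl : ∀ {x y} → x < y → y ≤ x → ⊥
  ≤-<-irrefl (x≤y , x≢y) y≤x = x≢y (antisym x≤y y≤x)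

  trace-above : ∀ x m {t} → run x m ≡ just t → All (x ≤_) (trace x m)
  trace-above x []      _ = ≤-refl ∷ []
  trace-above x (i ∷ m) r with up x i in e
  ... | just y = ≤-refl ∷ All.map (≤-trans (proj₁ (up-increasing e))) (trace-above y m r)

  trace-chain : ∀ x m {t} → run x m ≡ just t → Chain (trace x m)
  trace-chain x []      _ = [] ∷ []
  trace-chain x (i ∷ m) r with up x i in e
  ... | just y = All.map (<-≤-trans (up-increasing e)) (trace-above y m r) ∷ trace-chain y m r

  trace-saturated : ∀ x m → run x m ≡ just top → Saturated x (trace x m)
  trace-saturated x []      refl z x≤z _ = here (antisym (top-greatest z) x≤z)
  trace-saturated x (i ∷ m) r z x≤z comparable with up x i in e
  ... | just y with comparable y (there (here refl))
  ...   | inj₁ y≤z = there (trace-saturated y m r z y≤z (λ w w∈ → comparable w (there w∈)))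
  ...   | inj₂ z≤y with up-covers e x≤z z≤y
  ...     | inj₁ z≡x = here z≡x
  ...     | inj₂ z≡y = there (here z≡y)

  labels-trace : ∀ x m {t} → run x m ≡ just t → labels (trace x m) ≡ m
  labels-trace x []      _ = refl
  labels-trace x (i ∷ m) r with up x i in e
  ... | just y rewrite label-up e = cong (i ∷_) (labels-trace y m r)

  AllPairs-trichotomy : ∀ {R : Rel A 0ℓ} {D x y} → AllPairs R D → x ∈ D → y ∈ D → x ≡ y ⊎ R x y ⊎ R y x
  AllPairs-trichotomy (_ ∷ _)  (here refl) (here refl) = inj₁ refl
  AllPairs-trichotomy (p ∷ _)  (here refl) (there y∈)  = inj₂ (inj₁ (All.lookup p y∈))
  AllPairs-trichotomy (p ∷ _)  (there x∈)  (here refl) = inj₂ (inj₂ (All.lookup p x∈))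
  AllPairs-trichotomy (_ ∷ ps) (there x∈)  (there y∈)  = AllPairs-trichotomy ps x∈ y∈

  chain-comparable : ∀ {D x y} → Chain D → x ∈ D → y ∈ D → Comparable x y
  chain-comparable c x∈ y∈ with AllPairs-trichotomy c x∈ y∈
  ... | inj₁ refl            = inj₁ ≤-refl
  ... | inj₂ (inj₁ (x≤y , _)) = inj₁ x≤y
  ... | inj₂ (inj₂ (y≤x , _)) = inj₂ y≤x

  chain-insert : ∀ z L → Chain L → z ∉ L → (∀ w → w ∈ L → Comparable w z) →
                 Σ (List A) λ D → Chain D × (∀ x → x ∈ L → x ∈ D) × z ∈ D × (∀ x → x ∈ D → x ≡ z ⊎ x ∈ L)
  chain-insert z []      _       _   _          =
    z ∷ [] , [] ∷ [] , (λ _ ()) , here refl , λ { _ (here refl) → inj₁ refl }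
  chain-insert z (w ∷ L) (p ∷ c) z∉ comparable with comparable w (here refl)
  ... | inj₂ z≤w = z ∷ w ∷ L , (z<w ∷ All.map (<-trans isPartialOrder z<w) p) ∷ p ∷ c ,
                   (λ _ → there) , here refl , λ { _ (here refl) → inj₁ refl ; _ (there x∈) → inj₂ x∈ }
    where z<w : z < w
          z<w = z≤w , λ z≡w → z∉ (here z≡w)
  ... | inj₁ w≤z with chain-insert z L c (λ z∈ → z∉ (there z∈)) (λ v v∈ → comparable v (there v∈))
  ...   | D , cD , L⊆D , z∈D , D⊆z∷L =
    w ∷ D , All.tabulate w<D ∷ cD , (λ { _ (here refl) → here refl ; x (there x∈) → there (L⊆D x x∈) }) ,
    there z∈D , λ { _ (here refl) → inj₂ (here refl) ; x (there x∈) → Sum.map₂ there (D⊆z∷L x x∈) }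
    where w<D : ∀ {x} → x ∈ D → w < x
          w<D {x} x∈ with D⊆z∷L x x∈
          ... | inj₁ refl = w≤z , λ w≡z → z∉ (here (sym w≡z))
          ... | inj₂ x∈L  = All.lookup p x∈L

  maximal⇒saturated : ∀ {L} → Maximal L → Saturated bottom L
  maximal⇒saturated {L} (c , maximal) z _ comparable with z ∈? L
  ... | yes z∈L = z∈L
  ... | no  z∉L with chain-insert z L c z∉L comparable
  ...   | D , cD , L⊆D , z∈D , _ = maximal D cD L⊆D z z∈D

  saturated⇒maximal : ∀ {L} → Chain L → Saturated bottom L → Maximal L
  saturated⇒maximal c saturated =
    c , λ D cD L⊆D x x∈D → saturated x (bottom-least x) (λ w w∈ → chain-comparable cD (L⊆D w w∈) x∈D)

  saturated-chain-is-trace : ∀ x L → Chain (x ∷ L) → Saturated x (x ∷ L) →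
                             run x (labels (x ∷ L)) ≡ just top × trace x (labels (x ∷ L)) ≡ x ∷ L
  saturated-chain-is-trace x [] _ saturated with saturated top (top-greatest x) (λ { _ (here refl) → inj₁ (top-greatest x) })
  ... | here refl = refl , refl
  saturated-chain-is-trace x (y ∷ L) ((x<y ∷ x<L) ∷ y<L ∷ c) saturated
    with up-towards (proj₁ x<y) (proj₂ x<y)
  ... | i , z , e , z≤y with saturated z (proj₁ (up-increasing e)) z-comparable
    where
      z-comparable : ∀ w → w ∈ x ∷ y ∷ L → Comparable w z
      z-comparable _ (here refl)         = inj₁ (proj₁ (up-increasing e))
      z-comparable _ (there (here refl)) = inj₂ z≤y
      z-comparable _ (there (there w∈))  = inj₂ (≤-trans z≤y (proj₁ (All.lookup y<L w∈)))
  ... | here z≡x          = ⊥-elim (proj₂ (up-increasing e) (sym z≡x))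
  ... | there (there z∈L) = ⊥-elim (≤-<-irrefl (All.lookup y<L z∈L) z≤y)
  ... | there (here refl) rewrite label-up e | e =
    Product.map₂ (cong (x ∷_)) (saturated-chain-is-trace y L (y<L ∷ c) y-saturated)
    where
      y-saturated : Saturated y (y ∷ L)
      y-saturated w y≤w comparable with saturated w (≤-trans (proj₁ x<y) y≤w)
                                          (λ { _ (here refl) → inj₁ (≤-trans (proj₁ x<y) y≤w) ; v (there v∈) → comparable v v∈ })
      ... | here refl = ⊥-elim (≤-<-irrefl x<y y≤w)
      ... | there w∈  = w∈

  maximal⇒run : ∀ {L} → Maximal L → run bottom (labels L) ≡ just top × trace bottom (labels L) ≡ L
  maximal⇒run {L} mx with maximal⇒saturated mx bottom ≤-refl (λ w _ → inj₂ (bottom-least w))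
  maximal⇒run {x ∷ L} mx | here refl = saturated-chain-is-trace bottom L (proj₁ mx) (maximal⇒saturated mx)
  maximal⇒run {x ∷ L} mx | there b∈ with proj₁ mx
  ... | x<L ∷ _ = ⊥-elim (≤-<-irrefl (All.lookup x<L b∈) (bottom-least x))

  run⇒maximal : ∀ m → run bottom m ≡ just top → Maximal (trace bottom m)
  run⇒maximal m r = saturated⇒maximal (trace-chain bottom m r) (trace-saturated bottom m r)

  maximalChains⤖runs : Refinement (List A) Maximal ⤖ Refinement (List (Fin n)) (λ m → run bottom m ≡ just top)
  maximalChains⤖runs = ↔⇒⤖ (mk↔ₛ′ to from to∘from from∘to)
    where
      to : Refinement (List A) Maximal → Refinement (List (Fin n)) (λ m → run bottom m ≡ just top)
      to (L , [ mx ]) = labels L , [ proj₁ (maximal⇒run mx) ]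
      from : Refinement (List (Fin n)) (λ m → run bottom m ≡ just top) → Refinement (List A) Maximal
      from (m , [ r ]) = trace bottom m , [ run⇒maximal m r ]
      -- The proofs are irrelevant, but the equations they give are decidable and can be recomputed.
      to∘from : ∀ m → to (from m) ≡ m
      to∘from (m , [ r ]) = value-injective (labels-trace bottom m (recompute (Maybe.≡-dec _≟_ _ _) r))
      from∘to : ∀ L → from (to L) ≡ L
      from∘to (L , [ mx ]) = value-injective (recompute (List.≡-dec _≟_ _ _) (proj₂ (maximal⇒run mx)))

refinement-⤖ : {A : Set} {P Q : A → Set} (f : A → A) → (∀ x → f (f x) ≡ x) →
               (∀ {x} → P x → Q (f x)) → (∀ {x} → Q x → P (f x)) → Refinement A P ⤖ Refinement A Q
refinement-⤖ f f∘f≗id P⇒Q Q⇒P = ↔⇒⤖ (mk↔ₛ′ (Refinement.map f P⇒Q) (Refinement.map f Q⇒P)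
  (λ y → value-injective (f∘f≗id (value y))) (λ x → value-injective (f∘f≗id (value x))))

infix 4 _≤ᵥ_

_≤ᵥ_ : ∀ {n} → Vec ℕ n → Vec ℕ n → Set
_≤ᵥ_ = Pointwise ℕ._≤_

≤ᵥ-refl : ∀ {n} {u : Vec ℕ n} → u ≤ᵥ u
≤ᵥ-refl = Pointwise.refl ℕ.≤-refl

≤ᵥ-trans : ∀ {n} {u v w : Vec ℕ n} → u ≤ᵥ v → v ≤ᵥ w → u ≤ᵥ w
≤ᵥ-trans = Pointwise.trans ℕ.≤-trans

≤ᵥ-antisym : ∀ {n} {u v : Vec ℕ n} → u ≤ᵥ v → v ≤ᵥ u → u ≡ v
≤ᵥ-antisym []      []      = refl
≤ᵥ-antisym (a ∷ p) (b ∷ q) = cong₂ _∷_ (ℕ.≤-antisym a b) (≤ᵥ-antisym p q)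

zeros-≤ᵥ : ∀ {n} (u : Vec ℕ n) → replicate n 0 ≤ᵥ u
zeros-≤ᵥ []      = []
zeros-≤ᵥ (_ ∷ u) = z≤n ∷ zeros-≤ᵥ u

≤ᵥ-replicate : ∀ {n c} (u : Vec ℕ n) → (∀ i → lookup u i ℕ.≤ c) → u ≤ᵥ replicate n c
≤ᵥ-replicate []      _   = []
≤ᵥ-replicate (_ ∷ u) u≤c = u≤c Fin.zero ∷ ≤ᵥ-replicate u (λ i → u≤c (Fin.suc i))

lookup-extensional : ∀ {n} {u v : Vec ℕ n} → (∀ i → lookup u i ≡ lookup v i) → u ≡ v
lookup-extensional {u = u} {v} u≗v =
  trans (sym (Vec.tabulate∘lookup u)) (trans (Vec.tabulate-cong u≗v) (Vec.tabulate∘lookup v))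

sum-replicate : ∀ n c → Vec.sum (replicate n c) ≡ n * c
sum-replicate zero    c = refl
sum-replicate (suc n) c = cong (c +_) (sum-replicate n c)

increment : ∀ {n} → Fin n → Vec ℕ n → Vec ℕ n
increment i v = updateAt v i suc

increment-≥ : ∀ {n} i (u : Vec ℕ n) → u ≤ᵥ increment i u
increment-≥ Fin.zero    (x ∷ u) = ℕ.n≤1+n x ∷ ≤ᵥ-refl
increment-≥ (Fin.suc i) (x ∷ u) = ℕ.≤-refl ∷ increment-≥ i u

increment-≢ : ∀ {n} i (u : Vec ℕ n) → u ≢ increment i u
increment-≢ Fin.zero    (x ∷ u) e = ℕ.1+n≢n (sym (Vec.∷-injectiveˡ e))
increment-≢ (Fin.suc i) (x ∷ u) e = increment-≢ i u (Vec.∷-injectiveʳ e)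

increment-covers : ∀ {n} i {u w : Vec ℕ n} → u ≤ᵥ w → w ≤ᵥ increment i u → w ≡ u ⊎ w ≡ increment i u
increment-covers Fin.zero {a ∷ u} {b ∷ w} (a≤b ∷ u≤w) (b≤1+a ∷ w≤u)
  with ≤ᵥ-antisym w≤u u≤w | ℕ.m≤n⇒m<n∨m≡n b≤1+a
... | refl | inj₁ (s≤s b≤a) = inj₁ (cong (_∷ w) (ℕ.≤-antisym b≤a a≤b))
... | refl | inj₂ b≡1+a    = inj₂ (cong (_∷ w) b≡1+a)
increment-covers (Fin.suc i) {a ∷ u} {b ∷ w} (a≤b ∷ u≤w) (b≤a ∷ w≤u) with ℕ.≤-antisym b≤a a≤b
... | refl = Sum.map (cong (b ∷_)) (cong (b ∷_)) (increment-covers i u≤w w≤u)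

firstDifference : ∀ {n} → Vec ℕ n → Vec ℕ n → Maybe (Fin n)
firstDifference []      []      = nothing
firstDifference (a ∷ u) (b ∷ w) with a ℕ.≟ b
... | yes _ = Maybe.map Fin.suc (firstDifference u w)
... | no  _ = just Fin.zero

firstDifference-increment : ∀ {n} i (u : Vec ℕ n) → firstDifference u (increment i u) ≡ just i
firstDifference-increment Fin.zero (a ∷ u) with a ℕ.≟ suc a
... | yes a≡1+a = ⊥-elim (ℕ.1+n≢n (sym a≡1+a))
... | no  _     = refl
firstDifference-increment (Fin.suc i) (a ∷ u) with a ℕ.≟ a
... | yes _ rewrite firstDifference-increment i u = refl
... | no a≢a = ⊥-elim (a≢a refl)

-- The image of Σ^k_n C_1^n under the encoding below (encode-admissible, encode-onto).
record Admissible (k : ℕ) {n : ℕ} (h : Fin n → ℕ) : Set where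
  field
    bounded   : ∀ i → h i ℕ.≤ suc k
    ascending : ∀ i j → i Fin.< j → h i ℕ.≤ h j ⊎ k ℕ.≤ h j

open Admissible public

admissible? : ∀ k {n} (h : Fin n → ℕ) → Dec (Admissible k h)
admissible? k h =
  map′ (λ (b , a) → record { bounded = b ; ascending = a }) (λ a → bounded a , ascending a)
    (all? (λ i → h i ℕ.≤? suc k) ×-dec
     all? (λ i → all? (λ j → i Fin.<? j →-dec (h i ℕ.≤? h j ⊎-dec k ℕ.≤? h j))))

Admissible-cong : ∀ {k n} {g h : Fin n → ℕ} → (∀ i → g i ≡ h i) → Admissible k g → Admissible k h
Admissible-cong g≗h a = record
  { bounded   = λ i → subst (ℕ._≤ _) (g≗h i) (bounded a i)
  ; ascending = λ i j i<j → Sum.map (subst₂ ℕ._≤_ (g≗h i) (g≗h j)) (subst (_ ℕ.≤_) (g≗h j)) (ascending a i j i<j)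
  }

admissible-replicate : ∀ {k n c} → c ℕ.≤ suc k → Admissible k (lookup (replicate n c))
admissible-replicate {n = n} {c} c≤1+k = Admissible-cong (λ i → sym (Vec.lookup-replicate i c))
  record { bounded = λ _ → c≤1+k ; ascending = λ _ _ _ → inj₁ ℕ.≤-refl }

module _ {k n : ℕ} {a : ℕ} {v : Vec ℕ n} where

  admissible-∷ : a ℕ.≤ suc k → (∀ j → a ℕ.≤ lookup v j ⊎ k ℕ.≤ lookup v j) →
                 Admissible k (lookup v) → Admissible k (lookup (a ∷ v))
  admissible-∷ a≤1+k a-ascending av = record { bounded = bounded′ ; ascending = ascending′ }
    where
      bounded′ : ∀ i → lookup (a ∷ v) i ℕ.≤ suc k
      bounded′ Fin.zero    = a≤1+k
      bounded′ (Fin.suc i) = bounded av i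
      ascending′ : ∀ i j → i Fin.< j → lookup (a ∷ v) i ℕ.≤ lookup (a ∷ v) j ⊎ k ℕ.≤ lookup (a ∷ v) j
      ascending′ Fin.zero    (Fin.suc j) _         = a-ascending j
      ascending′ (Fin.suc i) (Fin.suc j) (s≤s i<j) = ascending av i j i<j

  admissible-head : Admissible k (lookup (a ∷ v)) → a ℕ.≤ suc k
  admissible-head av = bounded av Fin.zero

  admissible-head-ascending : Admissible k (lookup (a ∷ v)) → ∀ j → a ℕ.≤ lookup v j ⊎ k ℕ.≤ lookup v j
  admissible-head-ascending av j = ascending av Fin.zero (Fin.suc j) (s≤s z≤n)

  admissible-tail : Admissible k (lookup (a ∷ v)) → Admissible k (lookup v)
  admissible-tail av = record
    { bounded = λ i → bounded av (Fin.suc i) ; ascending = λ i j i<j → ascending av (Fin.suc i) (Fin.suc j) (s≤s i<j) }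

-- Raise the last coordinate in which u falls short of w: beyond it u agrees with w,
-- which keeps the raised vector admissible.
admissible-step-towards : ∀ k {n} (u w : Vec ℕ n) → Admissible k (lookup u) → Admissible k (lookup w) →
                          u ≤ᵥ w → u ≢ w → Σ (Fin n) λ i → Admissible k (lookup (increment i u)) × increment i u ≤ᵥ w
admissible-step-towards k []      []      _  _  _           u≢w = ⊥-elim (u≢w refl)
admissible-step-towards k (a ∷ u) (b ∷ w) au aw (a≤b ∷ u≤w) au≢bw with Vec.≡-dec ℕ._≟_ u w
... | no u≢w with admissible-step-towards k u w (admissible-tail au) (admissible-tail aw) u≤w u≢w
...   | i , au′ , u′≤w = Fin.suc i , admissible-∷ (admissible-head au) a-ascending au′ , a≤b ∷ u′≤w
  where
    a-ascending : ∀ j → a ℕ.≤ lookup (increment i u) j ⊎ k ℕ.≤ lookup (increment i u) j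
    a-ascending j = Sum.map (λ p → ℕ.≤-trans p (Pointwise.lookup (increment-≥ i u) j))
                                 (λ p → ℕ.≤-trans p (Pointwise.lookup (increment-≥ i u) j))
                                 (admissible-head-ascending au j)
admissible-step-towards k (a ∷ u) (b ∷ u) au aw (a≤b ∷ _) au≢bu | yes refl =
  Fin.zero , admissible-∷ (ℕ.≤-trans a<b (admissible-head aw)) a-ascending (admissible-tail au) , a<b ∷ ≤ᵥ-refl
  where
    a<b : a ℕ.< b
    a<b = ℕ.≤∧≢⇒< a≤b (λ a≡b → au≢bu (cong (_∷ u) a≡b))
    a-ascending : ∀ j → suc a ℕ.≤ lookup u j ⊎ k ℕ.≤ lookup u j
    a-ascending j = Sum.map₁ (ℕ.≤-trans a<b) (admissible-head-ascending aw j)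

admissible-suc : ∀ {k n} {h : Fin n → ℕ} → Admissible k h → Admissible (suc k) (λ i → suc (h i))
admissible-suc ah = record
  { bounded = λ i → s≤s (bounded ah i) ; ascending = λ i j i<j → Sum.map s≤s s≤s (ascending ah i j i<j) }

admissible-pred : ∀ {k n} {h : Fin n → ℕ} → Admissible (suc k) h → Admissible k (λ i → ℕ.pred (h i))
admissible-pred ah = record
  { bounded   = λ i → ℕ.pred-mono-≤ (bounded ah i)
  ; ascending = λ i j i<j → Sum.map ℕ.pred-mono-≤ ℕ.pred-mono-≤ (ascending ah i j i<j) }

admissible-map : ∀ {k n} (f : ℕ → ℕ) (v : Vec ℕ n) →
                 Admissible k (λ i → f (lookup v i)) → Admissible k (lookup (map f v))
admissible-map f v = Admissible-cong (λ i → sym (Vec.lookup-map i f v))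

-- Encoding Σ^k_n C_1^n by height vectors

≤′-irrelevant : ∀ {j n} (p q : j ≤′ n) → p ≡ q
≤′-irrelevant ≤′-refl      ≤′-refl      = refl
≤′-irrelevant (≤′-step p) (≤′-step q) = cong ≤′-step (≤′-irrelevant p q)
≤′-irrelevant ≤′-refl      (≤′-step q) = ⊥-elim (ℕ.<-irrefl refl (ℕ.≤′⇒≤ q))
≤′-irrelevant (≤′-step p) ≤′-refl      = ⊥-elim (ℕ.<-irrefl refl (ℕ.≤′⇒≤ p))

padZeros : ∀ {j n} → j ≤′ n → Vec ℕ j → Vec ℕ n
padZeros ≤′-refl      v = v
padZeros (≤′-step p) v = 0 ∷ padZeros p v

padZeros-replicate : ∀ {j} d (p : j ≤′ d + j) (v : Vec ℕ j) → padZeros p v ≡ replicate d 0 Vec.++ v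
padZeros-replicate zero    p v rewrite ≤′-irrelevant p ≤′-refl = refl
padZeros-replicate (suc d) (ℕ.≤′-reflexive e) v = ⊥-elim (ℕ.m≢1+n+m _ e)
padZeros-replicate (suc d) (≤′-step p) v = cong (0 ∷_) (padZeros-replicate d p v)

padZeros-shift : ∀ {j n} d (p : j ≤′ n) (q : d + j ≤′ n) (v : Vec ℕ j) →
                 padZeros p v ≡ padZeros q (replicate d 0 Vec.++ v)
padZeros-shift d p           ≤′-refl      v = padZeros-replicate d p v
padZeros-shift d (≤′-step p) (≤′-step q) v = cong (0 ∷_) (padZeros-shift d p q v)
padZeros-shift d ≤′-refl      (≤′-step q) v = ⊥-elim (ℕ.<-irrefl refl (ℕ.≤-trans (ℕ.m≤n+m _ d) (ℕ.≤′⇒≤ q)))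

padZeros-mono : ∀ {j n} (p : j ≤′ n) {u v} → u ≤ᵥ v → padZeros p u ≤ᵥ padZeros p v
padZeros-mono ≤′-refl      u≤v = u≤v
padZeros-mono (≤′-step p) u≤v = ℕ.≤-refl ∷ padZeros-mono p u≤v

padZeros-injective : ∀ {j n} (p : j ≤′ n) {u v} → padZeros p u ≡ padZeros p v → u ≡ v
padZeros-injective ≤′-refl      e = e
padZeros-injective (≤′-step p) e = padZeros-injective p (Vec.∷-injectiveʳ e)

map-suc-≤ᵥ⁻¹ : ∀ {n} {u w : Vec ℕ n} → map suc u ≤ᵥ map suc w → u ≤ᵥ w
map-suc-≤ᵥ⁻¹ {u = []}    {[]}    []            = []
map-suc-≤ᵥ⁻¹ {u = _ ∷ _} {_ ∷ _} (s≤s a≤b ∷ p) = a≤b ∷ map-suc-≤ᵥ⁻¹ p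

map-suc-injective : ∀ {n} {u w : Vec ℕ n} → map suc u ≡ map suc w → u ≡ w
map-suc-injective {u = []}    {[]}    _ = refl
map-suc-injective {u = _ ∷ _} {_ ∷ _} e =
  cong₂ _∷_ (ℕ.suc-injective (Vec.∷-injectiveˡ e)) (map-suc-injective (Vec.∷-injectiveʳ e))

zeros++-≤ᵥ-map-suc : ∀ {j} d (u : Vec ℕ j) (w : Vec ℕ (d + j)) →
                     replicate d 0 Vec.++ u ≤ᵥ w → replicate d 0 Vec.++ map suc u ≤ᵥ map suc w
zeros++-≤ᵥ-map-suc zero    u w       u≤w       = Pointwise.map⁺ s≤s u≤w
zeros++-≤ᵥ-map-suc (suc d) u (_ ∷ w) (_ ∷ u≤w) = z≤n ∷ zeros++-≤ᵥ-map-suc d u w u≤w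

padZeros-map-suc-≤ᵥ : ∀ {j n} d (p : j ≤′ n) (q : d + j ≤′ n) (u : Vec ℕ j) (w : Vec ℕ (d + j)) →
                      replicate d 0 Vec.++ u ≤ᵥ w → padZeros p (map suc u) ≤ᵥ padZeros q (map suc w)
padZeros-map-suc-≤ᵥ d p q u w u≤w rewrite padZeros-shift d p q (map suc u) =
  padZeros-mono q (zeros++-≤ᵥ-map-suc d u w u≤w)

padZeros-map-suc-≤ᵥ⁻¹ : ∀ {j m n} (p : j ≤′ n) (q : m ≤′ n) (u : Vec ℕ j) (w : Vec ℕ m) →
                        padZeros p (map suc u) ≤ᵥ padZeros q (map suc w) →
                        Σ ℕ λ d → Σ (d + j ≡ m) λ e → subst (Vec ℕ) e (replicate d 0 Vec.++ u) ≤ᵥ w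
padZeros-map-suc-≤ᵥ⁻¹ ≤′-refl      ≤′-refl      u       w       u≤w       = 0 , refl , map-suc-≤ᵥ⁻¹ u≤w
padZeros-map-suc-≤ᵥ⁻¹ (≤′-step p) (≤′-step q) u       w       (_ ∷ u≤w) = padZeros-map-suc-≤ᵥ⁻¹ p q u w u≤w
padZeros-map-suc-≤ᵥ⁻¹ ≤′-refl      (≤′-step q) (_ ∷ u) w       (() ∷ _)
padZeros-map-suc-≤ᵥ⁻¹ (≤′-step p) ≤′-refl      u       (_ ∷ w) (_ ∷ u≤w) with padZeros-map-suc-≤ᵥ⁻¹ p ≤′-refl u w u≤w
... | d , refl , u≤w′ = suc d , refl , z≤n ∷ u≤w′

padZeros-map-suc-length : ∀ {j m n} (p : j ≤′ n) (q : m ≤′ n) (u : Vec ℕ j) (w : Vec ℕ m) →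
                          padZeros p (map suc u) ≡ padZeros q (map suc w) → j ≡ m
padZeros-map-suc-length ≤′-refl      ≤′-refl      _       _       _ = refl
padZeros-map-suc-length (≤′-step p) (≤′-step q) u       w       e = padZeros-map-suc-length p q u w (Vec.∷-injectiveʳ e)
padZeros-map-suc-length ≤′-refl      (≤′-step q) (_ ∷ _) _       ()
padZeros-map-suc-length (≤′-step p) ≤′-refl      _       (_ ∷ _) ()

map-suc-pred : ∀ {n} (v : Vec ℕ n) → (∀ i → 0 ℕ.< lookup v i) → map suc (map ℕ.pred v) ≡ v
map-suc-pred []          _        = refl
map-suc-pred (zero ∷ v)  positive = ⊥-elim (ℕ.<-irrefl refl (positive Fin.zero))
map-suc-pred (suc a ∷ v) positive = cong (suc a ∷_) (map-suc-pred v (λ i → positive (Fin.suc i)))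

admissible-padZeros : ∀ {k j n} (p : j ≤′ n) {v : Vec ℕ j} →
                      Admissible k (lookup v) → Admissible k (lookup (padZeros p v))
admissible-padZeros ≤′-refl      av = av
admissible-padZeros (≤′-step p) av = admissible-∷ z≤n (λ _ → inj₁ z≤n) (admissible-padZeros p av)

-- Past its leading zeros, a vector admissible for k + 1 is positive:
-- later entries are at least the first nonzero one, or at least k.
admissible-unstack : ∀ k {n} (v : Vec ℕ n) → Admissible (suc k) (lookup v) →
                     Σ ℕ λ j → Σ (j ≤′ n) λ p → Σ (Vec ℕ j) λ u → Admissible k (lookup u) × padZeros p (map suc u) ≡ v
admissible-unstack k []           _  = 0 , ≤′-refl , [] , record { bounded = λ () ; ascending = λ () } , refl
admissible-unstack k (zero ∷ v)   av with admissible-unstack k v (admissible-tail av)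
... | j , p , u , au , e = j , ≤′-step p , u , au , cong (0 ∷_) e
admissible-unstack k (suc a ∷ v) av =
  _ , ≤′-refl , map ℕ.pred (suc a ∷ v) ,
  admissible-map ℕ.pred (suc a ∷ v) (admissible-pred av) , map-suc-pred (suc a ∷ v) positive
  where
    positive : ∀ i → 0 ℕ.< lookup (suc a ∷ v) i
    positive Fin.zero    = s≤s z≤n
    positive (Fin.suc i) = Sum.[ ℕ.≤-trans (s≤s z≤n) , ℕ.≤-trans (s≤s z≤n) ]′ (admissible-head-ascending av i)

bit : Bool → ℕ
bit false = 0
bit true  = 1

bit-mono : ∀ {a b} → a Bool.≤ b → bit a ℕ.≤ bit b
bit-mono Bool.f≤t = z≤n
bit-mono Bool.b≤b = ℕ.≤-refl

bit-reflects-≤ : ∀ a b → bit a ℕ.≤ bit b → a Bool.≤ b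
bit-reflects-≤ false false _ = Bool.b≤b
bit-reflects-≤ false true  _ = Bool.f≤t
bit-reflects-≤ true  true  _ = Bool.b≤b

bit-injective : ∀ {a b} → bit a ≡ bit b → a ≡ b
bit-injective {false} {false} _ = refl
bit-injective {true}  {true}  _ = refl

bit≤1 : ∀ b → bit b ℕ.≤ 1
bit≤1 false = z≤n
bit≤1 true  = s≤s z≤n

bits-onto : ∀ {n} (v : Vec ℕ n) → (∀ i → lookup v i ℕ.≤ 1) → Σ (Vec Bool n) λ x → map bit x ≡ v
bits-onto []                _ = [] , refl
bits-onto (zero ∷ v)        v≤1 = Product.map (false ∷_) (cong (0 ∷_)) (bits-onto v (λ i → v≤1 (Fin.suc i)))
bits-onto (suc zero ∷ v)    v≤1 = Product.map (true ∷_) (cong (1 ∷_)) (bits-onto v (λ i → v≤1 (Fin.suc i)))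
bits-onto (suc (suc _) ∷ v) v≤1 with v≤1 Fin.zero
... | s≤s ()

encode : (k n : ℕ) → El k n → Vec ℕ n
encode zero    n x           = map bit x
encode (suc k) n (j , p , x) = padZeros (ℕ.≤⇒≤′ p) (map suc (encode k j x))

encode-step : ∀ k n x → encode k (suc n) (step k n x) ≡ 0 ∷ encode k n x
encode-step zero    n x           = refl
encode-step (suc k) n (j , p , x) =
  cong (λ q → padZeros q (map suc (encode k j x))) (≤′-irrelevant _ (≤′-step (ℕ.≤⇒≤′ p)))

encode-iter : ∀ k j d x → encode k (d + j) (iter k j d x) ≡ replicate d 0 Vec.++ encode k j x
encode-iter k j zero    x = refl
encode-iter k j (suc d) x = trans (encode-step k (d + j) (iter k j d x)) (cong (0 ∷_) (encode-iter k j d x))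

encode-admissible : ∀ k n x → Admissible k (lookup (encode k n x))
encode-admissible zero    n x           = record
  { bounded   = λ i → subst (ℕ._≤ 1) (sym (Vec.lookup-map i bit x)) (bit≤1 (lookup x i))
  ; ascending = λ _ _ _ → inj₂ z≤n }
encode-admissible (suc k) n (j , p , x) =
  admissible-padZeros (ℕ.≤⇒≤′ p) (admissible-map suc (encode k j x) (admissible-suc (encode-admissible k j x)))

encode-onto : ∀ k n (v : Vec ℕ n) → Admissible k (lookup v) → Σ (El k n) λ x → encode k n x ≡ v
encode-onto zero    n v av = bits-onto v (bounded av)
encode-onto (suc k) n v av with admissible-unstack k v av
... | j , p , u , au , e with encode-onto k j u au
...   | x , ex = (j , ℕ.≤′⇒≤ p , x) ,
                 trans (cong₂ padZeros (≤′-irrelevant _ p) (cong (map suc) ex)) e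

encode-injective : ∀ k n {x y} → encode k n x ≡ encode k n y → x ≡ y
encode-injective zero    n       {[]}    {[]}    _ = refl
encode-injective zero    (suc n) {a ∷ x} {b ∷ y} e =
  cong₂ _∷_ (bit-injective (Vec.∷-injectiveˡ e)) (encode-injective zero n (Vec.∷-injectiveʳ e))
encode-injective (suc k) n {j , p , x} {m , q , y} e
  with padZeros-map-suc-length (ℕ.≤⇒≤′ p) (ℕ.≤⇒≤′ q) (encode k j x) (encode k m y) e
... | refl with ℕ.≤-irrelevant p q
...   | refl = cong (λ z → j , p , z) (encode-injective k j (map-suc-injective (padZeros-injective (ℕ.≤⇒≤′ p) e)))

encode-monotone : ∀ k n x y → Le k n x y → encode k n x ≤ᵥ encode k n y
encode-monotone zero    n       []      []      []       = []
encode-monotone zero    (suc n) (a ∷ x) (b ∷ y) (p ∷ ps) = bit-mono p ∷ encode-monotone zero n x y ps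
encode-monotone (suc k) n (j , p , x) (_ , q , y) (d , refl , x≤y) =
  padZeros-map-suc-≤ᵥ d (ℕ.≤⇒≤′ p) (ℕ.≤⇒≤′ q) (encode k j x) (encode k (d + j) y)
    (subst (_≤ᵥ encode k (d + j) y) (encode-iter k j d x) (encode-monotone k (d + j) (iter k j d x) y x≤y))

encode-reflects-≤ : ∀ k n x y → encode k n x ≤ᵥ encode k n y → Le k n x y
encode-reflects-≤ zero    n       []      []      []       = []
encode-reflects-≤ zero    (suc n) (a ∷ x) (b ∷ y) (p ∷ ps) = bit-reflects-≤ a b p ∷ encode-reflects-≤ zero n x y ps
encode-reflects-≤ (suc k) n (j , p , x) (m , q , y) x≤y
  with padZeros-map-suc-≤ᵥ⁻¹ (ℕ.≤⇒≤′ p) (ℕ.≤⇒≤′ q) (encode k j x) (encode k m y) x≤y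
... | d , refl , x≤y′ =
  d , refl , encode-reflects-≤ k (d + j) (iter k j d x) y (subst (_≤ᵥ encode k (d + j) y) (sym (encode-iter k j d x)) x≤y′)

-- Letter counts along words

occ-++ : ∀ {n} (i : Fin n) a b → occ i (a ++ b) ≡ occ i a + occ i b
occ-++ i a b = trans (cong length (List.filter-++ (Fin._≟ i) a b)) (List.length-++ (filter (Fin._≟ i) a))

occ-here : ∀ {n} (i : Fin n) z → occ i (i ∷ z) ≡ suc (occ i z)
occ-here i z = cong length (List.filter-accept (Fin._≟ i) refl)

occ-there : ∀ {n} {a i : Fin n} z → a ≢ i → occ i (a ∷ z) ≡ occ i z
occ-there z a≢i = cong length (List.filter-reject (Fin._≟ _) a≢i)

occ-reverse : ∀ {n} (i : Fin n) z → occ i (reverse z) ≡ occ i z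
occ-reverse i []      = refl
occ-reverse i (a ∷ z) = begin
  occ i (reverse (a ∷ z))            ≡⟨ cong (occ i) (List.unfold-reverse a z) ⟩
  occ i (reverse z ++ a ∷ [])        ≡⟨ occ-++ i (reverse z) (a ∷ []) ⟩
  occ i (reverse z) + occ i (a ∷ []) ≡⟨ cong (_+ occ i (a ∷ [])) (occ-reverse i z) ⟩
  occ i z + occ i (a ∷ [])           ≡⟨ ℕ.+-comm (occ i z) _ ⟩
  occ i (a ∷ []) + occ i z           ≡⟨ occ-++ i (a ∷ []) z ⟨
  occ i (a ∷ z)                      ∎

split-at-first : ∀ {n} (i : Fin n) b → 0 ℕ.< occ i b → ∃₂ λ c b′ → c ++ b′ ≡ b × occ i c ≡ 1
split-at-first i (a ∷ b) i∈b with a Fin.≟ i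
... | yes refl = a ∷ [] , b , refl , occ-here a []
... | no a≢i with split-at-first i b i∈b
...   | c , b′ , c++b′≡b , occ-c = a ∷ c , b′ , cong (a ∷_) c++b′≡b , trans (occ-there c a≢i) occ-c

walk : ∀ {n} → Vec ℕ n → List (Fin n) → Vec ℕ n
walk v []      = v
walk v (i ∷ m) = walk (increment i v) m

lookup-increment : ∀ {n} (a : Fin n) v i → lookup (increment a v) i ≡ lookup v i + occ i (a ∷ [])
lookup-increment a v i with a Fin.≟ i
... | yes refl = trans (Vec.lookup∘updateAt a v) (ℕ.+-comm 1 _)
... | no  a≢i  = trans (Vec.lookup∘updateAt′ i a (λ i≡a → a≢i (sym i≡a)) v) (sym (ℕ.+-identityʳ _))

lookup-walk : ∀ {n} (v : Vec ℕ n) m i → lookup (walk v m) i ≡ lookup v i + occ i m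
lookup-walk v []      i = sym (ℕ.+-identityʳ _)
lookup-walk v (a ∷ m) i = begin
  lookup (walk (increment a v) m) i               ≡⟨ lookup-walk (increment a v) m i ⟩
  lookup (increment a v) i + occ i m              ≡⟨ cong (_+ occ i m) (lookup-increment a v i) ⟩
  lookup v i + occ i (a ∷ []) + occ i m           ≡⟨ ℕ.+-assoc (lookup v i) _ _ ⟩
  lookup v i + (occ i (a ∷ []) + occ i m)         ≡⟨ cong (lookup v i +_) (occ-++ i (a ∷ []) m) ⟨
  lookup v i + occ i (a ∷ m)                      ∎

sum-walk : ∀ {n} (v : Vec ℕ n) m → Vec.sum (walk v m) ≡ Vec.sum v + length m
sum-walk v []      = sym (ℕ.+-identityʳ _)
sum-walk v (i ∷ m) = trans (sum-walk (increment i v) m) (trans (cong (_+ length m) (sum-increment i v)) (sym (ℕ.+-suc _ _)))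
  where
    sum-increment : ∀ {n} i (v : Vec ℕ n) → Vec.sum (increment i v) ≡ suc (Vec.sum v)
    sum-increment Fin.zero    (x ∷ v) = refl
    sum-increment (Fin.suc i) (x ∷ v) = trans (cong (x +_) (sum-increment i v)) (ℕ.+-suc x _)

walk-zeros : ∀ {n} m i → lookup (walk (replicate n 0) m) i ≡ occ i m
walk-zeros m i = trans (lookup-walk _ m i) (cong (_+ occ i m) (Vec.lookup-replicate i 0))

AdmissibleWalk : ∀ k {n} → Vec ℕ n → List (Fin n) → Set
AdmissibleWalk k v m = ∀ z r → z ++ r ≡ m → Admissible k (lookup (walk v z))

admissibleWalk-∷ : ∀ {k n i m} {v : Vec ℕ n} →
                   Admissible k (lookup v) → AdmissibleWalk k (increment i v) m → AdmissibleWalk k v (i ∷ m)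
admissibleWalk-∷ av _  []      _ _ = av
admissibleWalk-∷ _  aw (_ ∷ z) r e with List.∷-injective e
... | refl , z++r≡m = aw z r z++r≡m

admissibleWalk-tail : ∀ {k n i m} {v : Vec ℕ n} → AdmissibleWalk k v (i ∷ m) → AdmissibleWalk k (increment i v) m
admissibleWalk-tail {i = i} aw z r z++r≡m = aw (i ∷ z) r (cong (i ∷_) z++r≡m)

Balanced : ∀ k {n} → List (Fin n) → Set
Balanced k m = ∀ i → occ i m ≡ suc k

balanced⇒walk-zeros : ∀ {k n} (m : List (Fin n)) → Balanced k m → walk (replicate n 0) m ≡ replicate n (suc k)
balanced⇒walk-zeros {k} m balanced =
  lookup-extensional (λ i → trans (walk-zeros m i) (trans (balanced i) (sym (Vec.lookup-replicate i (suc k)))))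

walk-zeros⇒balanced : ∀ {k n} (m : List (Fin n)) → walk (replicate n 0) m ≡ replicate n (suc k) → Balanced k m
walk-zeros⇒balanced {k} m e i =
  trans (sym (walk-zeros m i)) (trans (cong (λ v → lookup v i) e) (Vec.lookup-replicate i (suc k)))

balanced-length : ∀ {k n} (m : List (Fin n)) → Balanced k m → length m ≡ suc k * n
balanced-length {k} {n} m balanced = begin
  length m                               ≡⟨ cong (_+ length m) (trans (sum-replicate n 0) (ℕ.*-zeroʳ n)) ⟨
  Vec.sum (replicate n 0) + length m     ≡⟨ sum-walk (replicate n 0) m ⟨
  Vec.sum (walk (replicate n 0) m)       ≡⟨ cong Vec.sum (balanced⇒walk-zeros m balanced) ⟩
  Vec.sum (replicate n (suc k))          ≡⟨ sum-replicate n (suc k) ⟩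
  n * suc k                              ≡⟨ ℕ.*-comm n (suc k) ⟩
  suc k * n                              ∎

balanced-reverse : ∀ {k n} (w : List (Fin n)) → Balanced k w → Balanced k (reverse w)
balanced-reverse w balanced i = trans (occ-reverse i w) (balanced i)

cross-≤ : ∀ {a b c d} → a + b ≡ c + d → c ℕ.≤ a → b ℕ.≤ d
cross-≤ {a} {b} {c} {d} a+b≡c+d c≤a =
  ℕ.+-cancelˡ-≤ c b d (ℕ.≤-trans (ℕ.+-monoˡ-≤ b c≤a) (ℕ.≤-reflexive a+b≡c+d))

AlmostDescending : ∀ {n} → (Fin n → ℕ) → Set
AlmostDescending g = ∀ i j → i Fin.< j → g j ℕ.≤ g i ⊎ g j ℕ.≤ 1

-- g and h stand for the letter counts of a prefix and of the complementary suffix of a balanced word.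
module Complement {k n} {g h : Fin n → ℕ} (g+h≡1+k : ∀ x → g x + h x ≡ suc k) where

  almostDescending⇒admissible : AlmostDescending g → Admissible k h
  almostDescending⇒admissible g-desc = record
    { bounded   = λ i → subst (h i ℕ.≤_) (g+h≡1+k i) (ℕ.m≤n+m (h i) (g i))
    ; ascending = λ i j i<j → Sum.map (cross-≤ (trans (g+h≡1+k i) (sym (g+h≡1+k j))))
                                           (cross-≤ (sym (g+h≡1+k j))) (g-desc i j i<j)
    }

  admissible⇒almostDescending : Admissible k h → AlmostDescending g
  admissible⇒almostDescending ah i j i<j = Sum.map
    (cross-≤ (trans (ℕ.+-comm (h j) (g j)) (trans (g+h≡1+k j) (sym (trans (ℕ.+-comm (h i) (g i)) (g+h≡1+k i))))))
    (cross-≤ (trans (ℕ.+-comm (h j) (g j)) (trans (g+h≡1+k j) (ℕ.+-comm 1 k))))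
    (ascending ah i j i<j)

PrefixAdmissible SuffixAdmissible : ∀ k {n} → List (Fin n) → Set
PrefixAdmissible k m = ∀ z r → z ++ r ≡ m → Admissible k (λ i → occ i z)
SuffixAdmissible k w = ∀ a b → a ++ b ≡ w → Admissible k (λ i → occ i b)

module _ {k n} {w : List (Fin n)} (balanced : Balanced k w) where

  occ-split : ∀ a b → a ++ b ≡ w → ∀ x → occ x a + occ x b ≡ suc k
  occ-split a b a++b≡w x = trans (sym (occ-++ x a b)) (trans (cong (occ x) a++b≡w) (balanced x))

  extend-to-first-occurrence : ∀ i a b → a ++ b ≡ w → occ i a ≡ 0 →
                               ∃₂ λ a′ b′ → a′ ++ b′ ≡ w × occ i a′ ≡ 1 × (∀ x → occ x a ℕ.≤ occ x a′)
  extend-to-first-occurrence i a b a++b≡w i∉a with split-at-first i b (subst (0 ℕ.<_) (sym occ-i-b) (s≤s z≤n))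
    where occ-i-b : occ i b ≡ suc k
          occ-i-b = trans (cong (_+ occ i b) (sym i∉a)) (occ-split a b a++b≡w i)
  ... | c , b′ , c++b′≡b , occ-i-c =
    a ++ c , b′ , trans (List.++-assoc a c b′) (trans (cong (a ++_) c++b′≡b) a++b≡w) ,
    trans (occ-++ i a c) (cong₂ _+_ i∉a occ-i-c) ,
    λ x → subst (occ x a ℕ.≤_) (sym (occ-++ x a c)) (ℕ.m≤m+n (occ x a) (occ x c))

  good⇒almostDescending : (∀ a b → a ++ b ≡ w → ∀ i → occ i a ≡ 0 ⊎ (∀ j → i Fin.< j → occ j a ℕ.≤ occ i a)) →
                          ∀ a b → a ++ b ≡ w → AlmostDescending (λ i → occ i a)
  good⇒almostDescending good a b a++b≡w i j i<j with good a b a++b≡w i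
  ... | inj₂ descending = inj₁ (descending j i<j)
  ... | inj₁ i∉a with extend-to-first-occurrence i a b a++b≡w i∉a
  ...   | a′ , b′ , a′++b′≡w , occ-i-a′ , a≤a′ with good a′ b′ a′++b′≡w i
  ...     | inj₁ i∉a′       = ⊥-elim (ℕ.1+n≢0 (trans (sym occ-i-a′) i∉a′))
  ...     | inj₂ descending = inj₂ (ℕ.≤-trans (a≤a′ j) (subst (occ j a′ ℕ.≤_) occ-i-a′ (descending j i<j)))

goodWord⇒balanced-suffixAdmissible : ∀ {k n} (w : List (Fin n)) → IsGoodWord k n w → Balanced k w × SuffixAdmissible k w
goodWord⇒balanced-suffixAdmissible w (_ , balanced , good) = balanced , λ a b a++b≡w →
  Complement.almostDescending⇒admissible (occ-split balanced a b a++b≡w) (good⇒almostDescending balanced good a b a++b≡w)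

balanced-suffixAdmissible⇒goodWord : ∀ {k n} (w : List (Fin n)) → Balanced k w → SuffixAdmissible k w → IsGoodWord k n w
balanced-suffixAdmissible⇒goodWord w balanced suffixAdmissible = balanced-length w balanced , balanced , good
  where
    good : ∀ a b → a ++ b ≡ w → ∀ i → occ i a ≡ 0 ⊎ (∀ j → i Fin.< j → occ j a ℕ.≤ occ i a)
    good a b a++b≡w i with occ i a ℕ.≟ 0
    ... | yes i∉a = inj₁ i∉a
    ... | no  i∈a = inj₂ λ j i<j →
      Sum.[ (λ j≤i → j≤i) , (λ j≤1 → ℕ.≤-trans j≤1 (ℕ.n≢0⇒n>0 i∈a)) ]′
        (Complement.admissible⇒almostDescending (occ-split balanced a b a++b≡w) (suffixAdmissible a b a++b≡w) i j i<j)

reverse-split : ∀ {A : Set} (z r w : List A) → z ++ r ≡ reverse w → reverse r ++ reverse z ≡ w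
reverse-split z r w e = trans (sym (List.reverse-++ z r)) (trans (cong reverse e) (List.reverse-involutive w))

suffixAdmissible⇒prefixAdmissible-reverse : ∀ {k n} (w : List (Fin n)) →
                                            SuffixAdmissible k w → PrefixAdmissible k (reverse w)
suffixAdmissible⇒prefixAdmissible-reverse w suffixAdmissible z r e =
  Admissible-cong (λ i → occ-reverse i z) (suffixAdmissible (reverse r) (reverse z) (reverse-split z r w e))

prefixAdmissible-reverse⇒suffixAdmissible : ∀ {k n} (w : List (Fin n)) →
                                            PrefixAdmissible k (reverse w) → SuffixAdmissible k w
prefixAdmissible-reverse⇒suffixAdmissible w prefixAdmissible a b e =
  Admissible-cong (λ i → occ-reverse i b)
    (prefixAdmissible (reverse b) (reverse a) (trans (sym (List.reverse-++ a b)) (cong reverse e)))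

-- The poset Σ^k_n C_1^n

module StackedPoset (k n : ℕ) where

  decode? : Vec ℕ n → Maybe (El k n)
  decode? v with admissible? k (lookup v)
  ... | yes av = just (proj₁ (encode-onto k n v av))
  ... | no  _  = nothing

  decode?-sound : ∀ v {x} → decode? v ≡ just x → encode k n x ≡ v
  decode?-sound v e with admissible? k (lookup v)
  decode?-sound v refl | yes av = proj₂ (encode-onto k n v av)

  decode?-complete : ∀ v → Admissible k (lookup v) → Σ (El k n) λ x → decode? v ≡ just x
  decode?-complete v av with admissible? k (lookup v)
  ... | yes _  = _ , refl
  ... | no ¬av = ⊥-elim (¬av av)

  isPartialOrder : IsPartialOrder _≡_ (Le k n)
  isPartialOrder = record
    { isPreorder = record
      { isEquivalence = isEquivalence
      ; reflexive     = λ { {x} refl → encode-reflects-≤ k n x x ≤ᵥ-refl }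
      ; trans         = λ {x} {y} {z} x≤y y≤z →
                          encode-reflects-≤ k n x z (≤ᵥ-trans (encode-monotone k n x y x≤y) (encode-monotone k n y z y≤z))
      }
    ; antisym = λ {x} {y} x≤y y≤x →
                  encode-injective k n (≤ᵥ-antisym (encode-monotone k n x y x≤y) (encode-monotone k n y x y≤x))
    }

  _≟_ : DecidableEquality (El k n)
  x ≟ y with Vec.≡-dec ℕ._≟_ (encode k n x) (encode k n y)
  ... | yes e  = yes (encode-injective k n e)
  ... | no  ¬e = no (λ e → ¬e (cong (encode k n) e))

  bottom top : El k n
  bottom = proj₁ (encode-onto k n (replicate n 0) (admissible-replicate ℕ.z≤n))
  top    = proj₁ (encode-onto k n (replicate n (suc k)) (admissible-replicate ℕ.≤-refl))

  encode-bottom : encode k n bottom ≡ replicate n 0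
  encode-bottom = proj₂ (encode-onto k n (replicate n 0) (admissible-replicate ℕ.z≤n))

  encode-top : encode k n top ≡ replicate n (suc k)
  encode-top = proj₂ (encode-onto k n (replicate n (suc k)) (admissible-replicate ℕ.≤-refl))

  bottom-least : ∀ x → Le k n bottom x
  bottom-least x = encode-reflects-≤ k n bottom x (subst (_≤ᵥ encode k n x) (sym encode-bottom) (zeros-≤ᵥ _))

  top-greatest : ∀ x → Le k n x top
  top-greatest x = encode-reflects-≤ k n x top
    (subst (encode k n x ≤ᵥ_) (sym encode-top) (≤ᵥ-replicate _ (bounded (encode-admissible k n x))))

  up : El k n → Fin n → Maybe (El k n)
  up x i = decode? (increment i (encode k n x))

  label : El k n → El k n → Maybe (Fin n)
  label x y = firstDifference (encode k n x) (encode k n y)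

  encode-up : ∀ {x i y} → up x i ≡ just y → encode k n y ≡ increment i (encode k n x)
  encode-up = decode?-sound _

  up-increasing : ∀ {x i y} → up x i ≡ just y → Le k n x y × x ≢ y
  up-increasing {x} {i} {y} e =
    encode-reflects-≤ k n x y (subst (encode k n x ≤ᵥ_) (sym (encode-up e)) (increment-≥ i (encode k n x))) ,
    λ { refl → increment-≢ i (encode k n x) (encode-up {x} {i} {x} e) }

  up-covers : ∀ {x i y z} → up x i ≡ just y → Le k n x z → Le k n z y → z ≡ x ⊎ z ≡ y
  up-covers {x} {i} {y} {z} e x≤z z≤y =
    Sum.map (encode-injective k n) (λ z≡y → encode-injective k n (trans z≡y (sym (encode-up e))))
      (increment-covers i (encode-monotone k n x z x≤z)
                          (subst (encode k n z ≤ᵥ_) (encode-up e) (encode-monotone k n z y z≤y)))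

  up-towards : ∀ {x y} → Le k n x y → x ≢ y → Σ (Fin n) λ i → Σ (El k n) λ z → up x i ≡ just z × Le k n z y
  up-towards {x} {y} x≤y x≢y
    with admissible-step-towards k (encode k n x) (encode k n y) (encode-admissible k n x) (encode-admissible k n y)
           (encode-monotone k n x y x≤y) (λ e → x≢y (encode-injective k n e))
  ... | i , admissible , x′≤y with decode?-complete _ admissible
  ...   | z , e = i , z , e , encode-reflects-≤ k n z y (subst (_≤ᵥ encode k n y) (sym (encode-up e)) x′≤y)

  label-up : ∀ {x i y} → up x i ≡ just y → label x y ≡ just i
  label-up {x} {i} e rewrite encode-up e = firstDifference-increment i (encode k n x)

  open MaximalChains isPartialOrder _≟_ bottom top bottom-least top-greatest up label
                     up-increasing up-covers up-towards label-up public

  run⇒walk : ∀ x m {y} → run x m ≡ just y → AdmissibleWalk k (encode k n x) m × encode k n y ≡ walk (encode k n x) m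
  run⇒walk x []      refl = (λ { [] _ _ → encode-admissible k n x ; (_ ∷ _) _ () }) , refl
  run⇒walk x (i ∷ m) {y} r with up x i in e
  ... | just x′ with subst (λ v → AdmissibleWalk k v m × encode k n y ≡ walk v m) (encode-up e) (run⇒walk x′ m r)
  ...   | aw , y≡ = admissibleWalk-∷ (encode-admissible k n x) aw , y≡

  walk⇒run : ∀ x m y → AdmissibleWalk k (encode k n x) m → encode k n y ≡ walk (encode k n x) m → run x m ≡ just y
  walk⇒run x []      y _  y≡x = cong just (encode-injective k n (sym y≡x))
  walk⇒run x (i ∷ m) y aw y≡ with decode?-complete (increment i (encode k n x)) (aw (i ∷ []) m refl)
  ... | x′ , e rewrite e =
    walk⇒run x′ m y (subst (λ v → AdmissibleWalk k v m) (sym (encode-up e)) (admissibleWalk-tail aw))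
                    (trans y≡ (cong (λ v → walk v m) (sym (encode-up e))))

  walk-bottom : ∀ z i → lookup (walk (encode k n bottom) z) i ≡ occ i z
  walk-bottom z i = trans (cong (λ v → lookup (walk v z) i) encode-bottom) (walk-zeros z i)

  run⇒balanced-prefixAdmissible : ∀ m → run bottom m ≡ just top → Balanced k m × PrefixAdmissible k m
  run⇒balanced-prefixAdmissible m r with run⇒walk bottom m r
  ... | aw , top≡ =
    walk-zeros⇒balanced m (trans (cong (λ v → walk v m) (sym encode-bottom)) (trans (sym top≡) encode-top)) ,
    λ z r e → Admissible-cong (walk-bottom z) (aw z r e)

  balanced-prefixAdmissible⇒run : ∀ m → Balanced k m → PrefixAdmissible k m → run bottom m ≡ just top
  balanced-prefixAdmissible⇒run m balanced prefixAdmissible = walk⇒run bottom m top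
    (λ z r e → Admissible-cong (λ i → sym (walk-bottom z i)) (prefixAdmissible z r e))
    (trans encode-top (trans (sym (balanced⇒walk-zeros m balanced)) (cong (λ v → walk v m) (sym encode-bottom))))

  runs⤖goodWords : Refinement (List (Fin n)) (λ m → run bottom m ≡ just top) ⤖ Word k n
  runs⤖goodWords = refinement-⤖ reverse List.reverse-involutive (λ {m} → run⇒goodWord m) (λ {w} → goodWord⇒run w)
    where
      run⇒goodWord : ∀ m → run bottom m ≡ just top → IsGoodWord k n (reverse m)
      run⇒goodWord m r with run⇒balanced-prefixAdmissible m r
      ... | balanced , prefixAdmissible = balanced-suffixAdmissible⇒goodWord (reverse m) (balanced-reverse m balanced)
              (prefixAdmissible-reverse⇒suffixAdmissible (reverse m)
                (subst (PrefixAdmissible k) (sym (List.reverse-involutive m)) prefixAdmissible))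
      goodWord⇒run : ∀ w → IsGoodWord k n w → run bottom (reverse w) ≡ just top
      goodWord⇒run w good with goodWord⇒balanced-suffixAdmissible w good
      ... | balanced , suffixAdmissible =
        balanced-prefixAdmissible⇒run (reverse w) (balanced-reverse w balanced)
          (suffixAdmissible⇒prefixAdmissible-reverse w suffixAdmissible)

theorem2p2 : (k n : ℕ) → MaxChain k n ⤖ Word k n
theorem2p2 k n = runs⤖goodWords ⤖-∘ maximalChains⤖runs
  where open StackedPoset k n
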